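{- Let $q=2^h$ and let $\delta,b_1,b_2\in\mathbb{F}_q^*$ with $\mathrm{Tr}(\delta)=1$, $\mathrm{Tr}(b_1)=\mathrm{Tr}(b_2)=0$ and $b_1\neq b_2$. Then there is no $A\in GL(4,\mathbb{F}_q)$ such that $\varphi_A$ maps $X_1X_2+X_3^2+X_3X_4+\delta X_4^2$ to $X_1X_2+X_3^2+X_3X_4+\delta X_4^2$ and maps $X_1X_2+X_3^2+X_3X_4+(\delta+b_1)X_4^2$ to $X_1X_2+X_3^2+X_3X_4+(\delta+b_2)X_4^2$.
   Context: $\mathrm{Tr}(x)=x+x^2+\cdots+x^{2^{h-1}}$ is the absolute trace of $\mathbb{F}_q$. Let $\Omega$ be the set of homogeneous quadratic polynomials in $X_1,X_2,X_3,X_4$ over $\mathbb{F}_q$. For $A\in GL(4,\mathbb{F}_q)$, $\varphi_A:\Omega\to\Omega$ is defined by $f(X_1,X_2,X_3,X_4)\mapsto f(X_1',X_2',X_3',X_4')$ where $[X_1'\,X_2'\,X_3'\,X_4']^T=A[X_1\,X_2\,X_3\,X_4]^T$. -}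

module Defs where

open import Level using (Level; _⊔_)
open import Data.Nat using (ℕ; zero; suc; _^_)
open import Data.Fin using (Fin; _<_) renaming (zero to f0; suc to fs)
open import Data.Product using (Σ; ∃; _×_; _,_)
open import Data.List using (List; length)
open import Data.List.Membership.Setoid using ()
open import Data.List.Relation.Unary.Any using (Any)
open import Data.List.Relation.Unary.AllPairs using (AllPairs)
open import Relation.Nullary using (¬_)
open import Relation.Binary.PropositionalEquality using (_≡_)
open import Algebra.Bundles using (CommutativeRing)

record IsFieldOfOrder {c ℓ : Level} (R : CommutativeRing c ℓ) (q : ℕ) : Set (c ⊔ ℓ) where
  open CommutativeRing R
  field
    1≉0      : ¬ (1# ≈ 0#)
    inverse  : ∀ x → ¬ (x ≈ 0#) → ∃ λ y → x * y ≈ 1#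
    elements : List Carrier
    complete : ∀ x → Any (x ≈_) elements
    distinct : AllPairs (λ x y → ¬ (x ≈ y)) elements
    size     : length elements ≡ q

module FieldNotions {c ℓ : Level} (R : CommutativeRing c ℓ) where
  open CommutativeRing R

  frob : ℕ → Carrier → Carrier
  frob zero    x = x
  frob (suc i) x = frob i x * frob i x

  Tr : ℕ → Carrier → Carrier
  Tr zero    x = 0#
  Tr (suc i) x = Tr i x + frob i x

  Σ4 : (Fin 4 → Carrier) → Carrier
  Σ4 f = f f0 + (f (fs f0) + (f (fs (fs f0)) + f (fs (fs (fs f0)))))

  Matrix : Set c
  Matrix = Fin 4 → Fin 4 → Carrier

  _⊗_ : Matrix → Matrix → Matrix
  (A ⊗ B) i j = Σ4 λ k → A i k * B k j

  I4 : Matrix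
  I4 i j with i Data.Fin.≟ j
  ... | Relation.Nullary.yes _ = 1#
  ... | Relation.Nullary.no  _ = 0#

  _≈M_ : Matrix → Matrix → Set ℓ
  A ≈M B = ∀ i j → A i j ≈ B i j

  IsInvertible : Matrix → Set (c ⊔ ℓ)
  IsInvertible A = ∃ λ B → (A ⊗ B) ≈M I4 × (B ⊗ A) ≈M I4

  -- Ω: a homogeneous quadratic polynomial  f = Σ_{i ≤ j} c i j · X_i X_j
  -- is given by its coefficient function c; only the entries with i ≤ j
  -- are coefficients (entries with i > j are ignored).
  QForm : Set c
  QForm = Fin 4 → Fin 4 → Carrier

  _≈Ω_ : QForm → QForm → Set ℓ
  f ≈Ω g = ∀ k l → ¬ (l < k) → f k l ≈ g k l

  -- coefficient of X_k X_l (k ≤ l) in X'_i X'_j, where X'_i = Σ_m A i m X_m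
  prodCoeff : Matrix → Fin 4 → Fin 4 → Fin 4 → Fin 4 → Carrier
  prodCoeff A i j k l with k Data.Fin.≟ l
  ... | Relation.Nullary.yes _ = A i k * A j k
  ... | Relation.Nullary.no  _ = A i k * A j l + A i l * A j k

  termCoeff : QForm → Matrix → Fin 4 → Fin 4 → Fin 4 → Fin 4 → Carrier
  termCoeff f A k l i j with Data.Fin._<?_ j i
  ... | Relation.Nullary.yes _ = 0#
  ... | Relation.Nullary.no  _ = f i j * prodCoeff A i j k l

  -- φ_A(f) = f(X'_1, …, X'_4) with [X'] = A [X]; coefficient of X_k X_l (k ≤ l)
  φ : Matrix → QForm → QForm
  φ A f k l = Σ4 λ i → Σ4 λ j → termCoeff f A k l i j

  -- X1 X2 + X3^2 + X3 X4 + d X4^2   (variables X1..X4 are indices 0..3)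
  Q : Carrier → QForm
  Q d f0           (fs f0)           = 1#
  Q d (fs (fs f0)) (fs (fs f0))      = 1#
  Q d (fs (fs f0)) (fs (fs (fs f0))) = 1#
  Q d (fs (fs (fs f0))) (fs (fs (fs f0))) = d
  Q d _ _ = 0#

-- A field with 2 ^ h elements has characteristic two: translating by 1 permutes its
-- elements, so 2 ^ h · 1 = 0. Subtracting the two hypotheses on A gives b₁ X₃'² = b₂ X₃²
-- with X₃' = Σ A₃ₘ Xₘ (variables indexed 0..3), and comparing the coefficients of the
-- squares forces the last row of A to be (0, 0, 0, a) with b₂ = a² b₁. As A preserves
-- Q δ, it preserves its polar form ⟨ x , y ⟩ = x₀y₁ + x₁y₀ + x₂y₃ + x₃y₂ (characteristic
-- two); against column 2 of A this says w A = e₃, where w is that column with its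
-- coordinates swapped in pairs. Hence w is the last row of A⁻¹, so a w = e₃, and
-- Q δ (A e₂) = 1 then gives a² = 1, i.e. b₂ = b₁.
module Submission where

open import Defs
open import Level using (Level)
open import Data.Nat using (ℕ; suc; _^_)
open import Data.Product using (∃; _×_)
open import Relation.Nullary using (¬_)
open import Algebra.Bundles using (CommutativeRing)

open import Data.Nat using (zero; z<s; s<s)
open import Data.Fin using (Fin; _<_; _≟_; _<?_) renaming (zero to f0; suc to fs)
open import Data.Fin.Properties using (<-irrefl; <-asym; <⇒≢)
open import Data.Vec.Functional using (Vector)
open import Data.List using ([]; _∷_; _++_; foldr; map; length)
open import Data.List.Relation.Unary.All using (All)
import Data.List.Relation.Unary.All as All
open import Data.List.Relation.Unary.All.Properties using (All¬⇒¬Any)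
open import Data.List.Relation.Unary.AllPairs using (_∷_)
import Data.List.Relation.Unary.AllPairs as AllPairs
open import Data.List.Relation.Unary.Any using (here; there)
open import Data.Product using (_,_)
open import Data.Empty using (⊥; ⊥-elim)
open import Relation.Nullary using (yes; no)
open import Relation.Nullary.Negation using (¬¬-map)
open import Relation.Binary.Bundles using (Setoid)
open import Relation.Binary.PropositionalEquality as ≡ using (_≡_; _≢_)
import Data.List.Relation.Binary.Permutation.Setoid as Permutation
import Data.List.Relation.Binary.Permutation.Setoid.Properties as PermutationProperties
import Data.List.Membership.Setoid as Membership
import Data.List.Membership.Setoid.Properties as MembershipProperties
import Data.List.Relation.Unary.Unique.Setoid as UniqueSetoid
import Data.List.Relation.Unary.Unique.Setoid.Properties as UniqueProperties
import Data.List.Relation.Binary.Subset.Setoid as Subset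
import Algebra.Properties.Semiring.Mult as Mult
import Algebra.Properties.Semiring.Sum as Sum
import Algebra.Properties.Group as GroupProperties
import Algebra.Properties.CommutativeSemigroup as CommutativeSemigroupProperties
import Algebra.Solver.Ring.NaturalCoefficients.Default as NaturalCoefficients
import Relation.Binary.Reasoning.Setoid as SetoidReasoning

module _ {a ℓ : Level} (S : Setoid a ℓ) where
  open Setoid S
  open Permutation S using (_↭_; ↭-refl; ↭-trans; ↭-sym; ↭-reflexive-≋; prep)
  open PermutationProperties S using (∈-resp-↭; Unique-resp-↭; shift)
  open Membership S using (_∈_)
  open UniqueSetoid S using (Unique)
  open Subset S using (_⊆_)

  private
    ∉-resp-≈ : ∀ {x y xs} → All (λ z → ¬ x ≈ z) xs → x ≈ y → ¬ y ∈ xs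
    ∉-resp-≈ x∉ x≈y = All¬⇒¬Any (All.map (λ x≉z y≈z → x≉z (trans x≈y y≈z)) x∉)

  unique∧set⇒↭ : ∀ {xs ys} → Unique xs → Unique ys → xs ⊆ ys → ys ⊆ xs → xs ↭ ys
  unique∧set⇒↭ {[]}     {[]}    _ _ _ _ = ↭-refl
  unique∧set⇒↭ {[]}     {_ ∷ _} _ _ _ ys⊆ with ys⊆ (here refl)
  ... | ()
  unique∧set⇒↭ {x ∷ xs} {ys} (x∉xs ∷ xs!) ys! xs⊆ ys⊆
    with MembershipProperties.∈-∃++ S (xs⊆ (here refl))
  ... | us , vs , w , x≈w , ys≋ =
    ↭-trans (prep x≈w (unique∧set⇒↭ xs! usvs! xs⊆usvs usvs⊆xs)) (↭-sym ys↭)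
    where
    ys↭ : ys ↭ w ∷ us ++ vs
    ys↭ = ↭-trans (↭-reflexive-≋ ys≋) (shift refl us vs)
    wusvs! : Unique (w ∷ us ++ vs)
    wusvs! = Unique-resp-↭ ys↭ ys!
    usvs! : Unique (us ++ vs)
    usvs! = AllPairs.tail wusvs!
    xs⊆usvs : xs ⊆ us ++ vs
    xs⊆usvs z∈xs with ∈-resp-↭ ys↭ (xs⊆ (there z∈xs))
    ... | here z≈w = ⊥-elim (∉-resp-≈ x∉xs (trans x≈w (sym z≈w)) z∈xs)
    ... | there z∈ = z∈
    usvs⊆xs : us ++ vs ⊆ xs
    usvs⊆xs z∈ with ys⊆ (∈-resp-↭ (↭-sym ys↭) (there z∈))
    ... | here z≈x   = ⊥-elim (∉-resp-≈ (AllPairs.head wusvs!) (trans (sym x≈w) (sym z≈x)) z∈)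
    ... | there z∈xs = z∈xs

module _ {c ℓ : Level} (R : CommutativeRing c ℓ) where
  open CommutativeRing R
  open FieldNotions R
  open Mult semiring using (×-congˡ; ×1-homo-*) renaming (_×_ to _·_)
  open Sum semiring using (sum; ∑-comm; sum-cong-≋; *-distribˡ-sum; *-distribʳ-sum)
  open NaturalCoefficients commutativeSemiring using (solve; Polynomial; _:+_; _:*_; _:^_; _:=_; con)
  open GroupProperties +-group using (∙-cancelˡ; identityˡ-unique; identityʳ-unique; \\-leftDividesˡ)
  open CommutativeSemigroupProperties +-commutativeSemigroup using (interchange)
  open SetoidReasoning setoid
  open Membership setoid using (_∈_)
  open UniqueSetoid setoid using (Unique)

  -- Characteristic two

  sum-map-1+ : ∀ xs → foldr _+_ 0# (map (1# +_) xs) ≈ length xs · 1# + foldr _+_ 0# xs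
  sum-map-1+ []       = sym (+-identityˡ 0#)
  sum-map-1+ (x ∷ xs) = trans (+-congˡ (sum-map-1+ xs)) (interchange 1# x _ _)

  length·1≈0 : ∀ {xs} → Unique xs → (∀ x → x ∈ xs) → length xs · 1# ≈ 0#
  length·1≈0 {xs} xs! xs-complete = identityˡ-unique _ _ (begin
    length xs · 1# + foldr _+_ 0# xs
      ≈⟨ sum-map-1+ xs ⟨
    foldr _+_ 0# (map (1# +_) xs)
      ≈⟨ PermutationProperties.foldr-commMonoid setoid +-isCommutativeMonoid xs↭ ⟨
    foldr _+_ 0# xs
      ∎)
    where
    shifted-complete : ∀ z → z ∈ map (1# +_) xs
    shifted-complete z = MembershipProperties.∈-resp-≈ setoid (\\-leftDividesˡ 1# z)
      (MembershipProperties.∈-map⁺ setoid setoid +-congˡ (xs-complete _))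
    xs↭ : Permutation._↭_ setoid xs (map (1# +_) xs)
    xs↭ = unique∧set⇒↭ setoid xs! (UniqueProperties.map⁺ setoid setoid (∙-cancelˡ 1# _ _) xs!)
      (λ {z} _ → shifted-complete z) (λ {z} _ → xs-complete z)

  module _ (inverse : ∀ x → ¬ x ≈ 0# → ∃ λ y → x * y ≈ 1#) where

    x*y≈0⇒y≈0 : ∀ {x y} → ¬ x ≈ 0# → x * y ≈ 0# → y ≈ 0#
    x*y≈0⇒y≈0 {x} {y} x≉0 xy≈0 with inverse x x≉0
    ... | x⁻¹ , xx⁻¹≈1 = begin
      y              ≈⟨ *-identityˡ y ⟨
      1# * y         ≈⟨ *-congʳ (trans (*-comm x⁻¹ x) xx⁻¹≈1) ⟨
      x⁻¹ * x * y    ≈⟨ *-assoc x⁻¹ x y ⟩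
      x⁻¹ * (x * y)  ≈⟨ *-congˡ xy≈0 ⟩
      x⁻¹ * 0#       ≈⟨ zeroʳ x⁻¹ ⟩
      0#             ∎

    x*x≈0⇒¬¬x≈0 : ∀ {x} → x * x ≈ 0# → ¬ ¬ x ≈ 0#
    x*x≈0⇒¬¬x≈0 xx≈0 x≉0 = x≉0 (x*y≈0⇒y≈0 x≉0 xx≈0)

    m^h·1≈0⇒¬¬m·1≈0 : ∀ m h → (m ^ h) · 1# ≈ 0# → ¬ ¬ m · 1# ≈ 0#
    m^h·1≈0⇒¬¬m·1≈0 m zero    1+0≈0 m·1≉0 = m·1≉0 (begin
      m · 1#         ≈⟨ *-identityʳ (m · 1#) ⟨
      m · 1# * 1#    ≈⟨ *-congˡ (trans (sym (+-identityʳ 1#)) 1+0≈0) ⟩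
      m · 1# * 0#    ≈⟨ zeroʳ (m · 1#) ⟩
      0#             ∎)
    m^h·1≈0⇒¬¬m·1≈0 m (suc h) m^[1+h]·1≈0 m·1≉0 = m^h·1≈0⇒¬¬m·1≈0 m h m^h·1≈0 m·1≉0
      where
      m^h·1≈0 : (m ^ h) · 1# ≈ 0#
      m^h·1≈0 = x*y≈0⇒y≈0 m·1≉0 (trans (sym (×1-homo-* m (m ^ h))) m^[1+h]·1≈0)

  characteristic-two : ∀ {h} → IsFieldOfOrder R (2 ^ h) → ¬ ¬ (1# + 1# ≈ 0#)
  characteristic-two {h} F = ¬¬-map (trans (+-congˡ (sym (+-identityʳ 1#))))
    (m^h·1≈0⇒¬¬m·1≈0 inverse 2 h (trans (×-congˡ (≡.sym size)) (length·1≈0 distinct complete)))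
    where open IsFieldOfOrder F

  -- Coefficients of φ A f

  i0 i1 i2 i3 : Fin 4
  i0 = f0
  i1 = fs f0
  i2 = fs (fs f0)
  i3 = fs (fs (fs f0))

  Σ4-cong : ∀ {g g′ : Fin 4 → Carrier} → (∀ i → g i ≈ g′ i) → Σ4 g ≈ Σ4 g′
  Σ4-cong g≈g′ = +-cong (g≈g′ i0) (+-cong (g≈g′ i1) (+-cong (g≈g′ i2) (g≈g′ i3)))

  Σ4≈sum : ∀ (g : Fin 4 → Carrier) → Σ4 g ≈ sum g
  Σ4≈sum g = +-congˡ (+-congˡ (+-congˡ (sym (+-identityʳ (g i3)))))

  upperTerm : QForm → (Fin 4 → Fin 4 → Carrier) → Fin 4 → Fin 4 → Carrier
  upperTerm f m i j with j <? i
  ... | yes _ = 0#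
  ... | no _  = f i j * m i j

  Σupper : QForm → (Fin 4 → Fin 4 → Carrier) → Carrier
  Σupper f m = Σ4 λ i → Σ4 λ j → upperTerm f m i j

  Σupper-cong : ∀ f {m m′} → (∀ i j → m i j ≈ m′ i j) → Σupper f m ≈ Σupper f m′
  Σupper-cong f {m} {m′} m≈m′ = Σ4-cong λ i → Σ4-cong λ j → upperTerm-cong i j
    where
    upperTerm-cong : ∀ i j → upperTerm f m i j ≈ upperTerm f m′ i j
    upperTerm-cong i j with j <? i
    ... | yes _ = refl
    ... | no _  = *-congˡ (m≈m′ i j)

  φ≈Σupper : ∀ A f k l → φ A f k l ≈ Σupper f (λ i j → prodCoeff A i j k l)
  φ≈Σupper A f k l = Σ4-cong λ i → Σ4-cong λ j → reflexive (termCoeff≡upperTerm i j)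
    where
    termCoeff≡upperTerm : ∀ i j → termCoeff f A k l i j ≡ upperTerm f (λ i j → prodCoeff A i j k l) i j
    termCoeff≡upperTerm i j with j <? i
    ... | yes _ = ≡.refl
    ... | no _  = ≡.refl

  prodCoeff-diagonal : ∀ A i j k → prodCoeff A i j k k ≡ A i k * A j k
  prodCoeff-diagonal A i j k with k ≟ k
  ... | yes _   = ≡.refl
  ... | no k≢k  = ⊥-elim (k≢k ≡.refl)

  prodCoeff-offdiagonal : ∀ A i j {k l} → k ≢ l → prodCoeff A i j k l ≡ A i k * A j l + A i l * A j k
  prodCoeff-offdiagonal A i j {k} {l} k≢l with k ≟ l
  ... | yes k≡l = ⊥-elim (k≢l k≡l)
  ... | no _    = ≡.refl

  column : Matrix → Fin 4 → Vector Carrier 4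
  column A k i = A i k

  eval : QForm → Vector Carrier 4 → Carrier
  eval f x = Σupper f λ i j → x i * x j

  polarForm : QForm → Vector Carrier 4 → Vector Carrier 4 → Carrier
  polarForm f x y = Σupper f λ i j → x i * y j + y i * x j

  φ-diagonal : ∀ A f k → φ A f k k ≈ eval f (column A k)
  φ-diagonal A f k = trans (φ≈Σupper A f k k)
    (Σupper-cong f λ i j → reflexive (prodCoeff-diagonal A i j k))

  φ-offdiagonal : ∀ A f {k l} → k ≢ l → φ A f k l ≈ polarForm f (column A k) (column A l)
  φ-offdiagonal A f {k} {l} k≢l = trans (φ≈Σupper A f k l)
    (Σupper-cong f λ i j → reflexive (prodCoeff-offdiagonal A i j k≢l))

  -- con 0 :^ 0 denotes 1# on the nose (con 1 denotes 1# + 0#), so solver terms built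
  -- from O and I match the unfolded sums below definitionally.
  private
    O I : ∀ {n} → Polynomial n
    O = con 0
    I = con 0 :^ 0

  Σupper-Q : ∀ d m → Σupper (Q d) m ≈ m i0 i1 + m i2 i2 + m i2 i3 + d * m i3 i3
  Σupper-Q d m = solve 11 (λ a b c e f g h p r s d →
      (O :* a :+ (I :* b :+ (O :* c :+ O :* e))) :+ ((O :+ (O :* f :+ (O :* g :+ O :* h)))
        :+ ((O :+ (O :+ (I :* p :+ I :* r))) :+ (O :+ (O :+ (O :+ d :* s)))))
      := b :+ p :+ r :+ d :* s) refl
      (m i0 i0) (m i0 i1) (m i0 i2) (m i0 i3) (m i1 i1) (m i1 i2) (m i1 i3) (m i2 i2) (m i2 i3) (m i3 i3) d

  eval-Q-+ : ∀ d b x → eval (Q (d + b)) x ≈ eval (Q d) x + b * (x i3 * x i3)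
  eval-Q-+ d b x = begin
    eval (Q (d + b)) x                  ≈⟨ Σupper-Q (d + b) (λ i j → x i * x j) ⟩
    p + (d + b) * s                     ≈⟨ +-congˡ (distribʳ s d b) ⟩
    p + (d * s + b * s)                 ≈⟨ +-assoc p (d * s) (b * s) ⟨
    p + d * s + b * s                   ≈⟨ +-congʳ (Σupper-Q d (λ i j → x i * x j)) ⟨
    eval (Q d) x + b * s                ∎
    where
    p s : Carrier
    p = x i0 * x i1 + x i2 * x i2 + x i2 * x i3
    s = x i3 * x i3

  eval-Q-x3≈0 : ∀ d x → x i3 ≈ 0# → eval (Q d) x ≈ x i0 * x i1 + x i2 * x i2
  eval-Q-x3≈0 d x x3≈0 = begin
    eval (Q d) x
      ≈⟨ Σupper-Q d (λ i j → x i * x j) ⟩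
    x i0 * x i1 + x i2 * x i2 + x i2 * x i3 + d * (x i3 * x i3)
      ≈⟨ +-cong (+-congˡ x2x3≈0) (trans (*-congˡ x3x3≈0) (zeroʳ d)) ⟩
    x i0 * x i1 + x i2 * x i2 + 0# + 0#
      ≈⟨ trans (+-identityʳ _) (+-identityʳ _) ⟩
    x i0 * x i1 + x i2 * x i2
      ∎
    where
    x2x3≈0 : x i2 * x i3 ≈ 0#
    x2x3≈0 = trans (*-congˡ x3≈0) (zeroʳ (x i2))
    x3x3≈0 : x i3 * x i3 ≈ 0#
    x3x3≈0 = trans (*-congˡ x3≈0) (zeroʳ (x i3))

  swapPairs : Vector Carrier 4 → Vector Carrier 4
  swapPairs x f0                = x i1
  swapPairs x (fs f0)           = x i0
  swapPairs x (fs (fs f0))      = x i3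
  swapPairs x (fs (fs (fs f0))) = x i2

  -- Written so that ⟨ x , column A j ⟩ is literally (swapPairs x ⊙ A) j.
  ⟨_,_⟩ : Vector Carrier 4 → Vector Carrier 4 → Carrier
  ⟨ x , y ⟩ = sum λ i → swapPairs x i * y i

  ⟨⟩-sym : ∀ x y → ⟨ x , y ⟩ ≈ ⟨ y , x ⟩
  ⟨⟩-sym x y = solve 8 (λ x0 x1 x2 x3 y0 y1 y2 y3 →
      x1 :* y0 :+ (x0 :* y1 :+ (x3 :* y2 :+ (x2 :* y3 :+ O)))
      := y1 :* x0 :+ (y0 :* x1 :+ (y3 :* x2 :+ (y2 :* x3 :+ O)))) refl
    (x i0) (x i1) (x i2) (x i3) (y i0) (y i1) (y i2) (y i3)

  module _ (1+1≈0 : 1# + 1# ≈ 0#) where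

    x+x≈0 : ∀ x → x + x ≈ 0#
    x+x≈0 x = begin
      x + x            ≈⟨ +-cong (*-identityˡ x) (*-identityˡ x) ⟨
      1# * x + 1# * x  ≈⟨ distribʳ x 1# 1# ⟨
      (1# + 1#) * x    ≈⟨ *-congʳ 1+1≈0 ⟩
      0# * x           ≈⟨ zeroˡ x ⟩
      0#               ∎

    ⟨x,x⟩≈0 : ∀ x → ⟨ x , x ⟩ ≈ 0#
    ⟨x,x⟩≈0 x = begin
      ⟨ x , x ⟩                                        ≈⟨ rearrange (x i0) (x i1) (x i2) (x i3) ⟩
      (x i0 * x i1 + x i0 * x i1) + (x i2 * x i3 + x i2 * x i3)  ≈⟨ +-cong (x+x≈0 _) (x+x≈0 _) ⟩
      0# + 0#                                          ≈⟨ +-identityˡ 0# ⟩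
      0#                                               ∎
      where
      rearrange : ∀ x0 x1 x2 x3 → x1 * x0 + (x0 * x1 + (x3 * x2 + (x2 * x3 + 0#)))
                    ≈ (x0 * x1 + x0 * x1) + (x2 * x3 + x2 * x3)
      rearrange = solve 4 (λ x0 x1 x2 x3 → x1 :* x0 :+ (x0 :* x1 :+ (x3 :* x2 :+ (x2 :* x3 :+ O)))
        := (x0 :* x1 :+ x0 :* x1) :+ (x2 :* x3 :+ x2 :* x3)) refl

    polarForm-Q : ∀ d x y → polarForm (Q d) x y ≈ ⟨ x , y ⟩
    polarForm-Q d x y = begin
      polarForm (Q d) x y             ≈⟨ Σupper-Q d (λ i j → x i * y j + y i * x j) ⟩
      _                               ≈⟨ rearrange (x i0) (x i1) (x i2) (x i3) (y i0) (y i1) (y i2) (y i3) d ⟩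
      ⟨ x , y ⟩ + (x i2 * y i2 + x i2 * y i2) + d * (x i3 * y i3 + x i3 * y i3)
                                      ≈⟨ +-cong (+-congˡ (x+x≈0 _)) (trans (*-congˡ (x+x≈0 _)) (zeroʳ d)) ⟩
      ⟨ x , y ⟩ + 0# + 0#             ≈⟨ trans (+-identityʳ _) (+-identityʳ _) ⟩
      ⟨ x , y ⟩                       ∎
      where
      rearrange : ∀ x0 x1 x2 x3 y0 y1 y2 y3 d →
        (x0 * y1 + y0 * x1) + (x2 * y2 + y2 * x2) + (x2 * y3 + y2 * x3) + d * (x3 * y3 + y3 * x3)
        ≈ (x1 * y0 + (x0 * y1 + (x3 * y2 + (x2 * y3 + 0#))))
          + (x2 * y2 + x2 * y2) + d * (x3 * y3 + x3 * y3)
      rearrange = solve 9 (λ x0 x1 x2 x3 y0 y1 y2 y3 d →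
        (x0 :* y1 :+ y0 :* x1) :+ (x2 :* y2 :+ y2 :* x2) :+ (x2 :* y3 :+ y2 :* x3) :+ d :* (x3 :* y3 :+ y3 :* x3)
        := (x1 :* y0 :+ (x0 :* y1 :+ (x3 :* y2 :+ (x2 :* y3 :+ O))))
           :+ (x2 :* y2 :+ x2 :* y2) :+ d :* (x3 :* y3 :+ x3 :* y3)) refl

  _⊙_ : Vector Carrier 4 → Matrix → Vector Carrier 4
  (w ⊙ A) j = sum λ i → w i * A i j

  ⊙-congˡ : ∀ {v v′} B → (∀ k → v k ≈ v′ k) → ∀ j → (v ⊙ B) j ≈ (v′ ⊙ B) j
  ⊙-congˡ {v} {v′} B v≈v′ j =
    sum-cong-≋ {x = λ k → v k * B k j} {y = λ k → v′ k * B k j} λ k → *-congʳ (v≈v′ k)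

  ⊙-congʳ : ∀ w {A A′} → A ≈M A′ → ∀ j → (w ⊙ A) j ≈ (w ⊙ A′) j
  ⊙-congʳ w {A} {A′} A≈A′ j =
    sum-cong-≋ {x = λ i → w i * A i j} {y = λ i → w i * A′ i j} λ i → *-congˡ (A≈A′ i j)

  ⊗≈⊙ : ∀ A B i j → (A ⊗ B) i j ≈ (A i ⊙ B) j
  ⊗≈⊙ A B i j = Σ4≈sum (λ k → A i k * B k j)

  *-distribˡ-⊙ : ∀ a v B j → a * (v ⊙ B) j ≈ ((λ k → a * v k) ⊙ B) j
  *-distribˡ-⊙ a v B j =
    trans (*-distribˡ-sum a (λ k → v k * B k j)) (sum-cong-≋ λ k → sym (*-assoc a (v k) (B k j)))

  ⊙-assoc : ∀ w A B j → ((w ⊙ A) ⊙ B) j ≈ (w ⊙ (A ⊗ B)) j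
  ⊙-assoc w A B j = begin
    (sum λ k → (sum λ i → w i * A i k) * B k j)
      ≈⟨ sum-cong-≋ (λ k → *-distribʳ-sum (B k j) (λ i → w i * A i k)) ⟩
    (sum λ k → sum λ i → w i * A i k * B k j)
      ≈⟨ ∑-comm (λ k i → w i * A i k * B k j) ⟩
    (sum λ i → sum λ k → w i * A i k * B k j)
      ≈⟨ sum-cong-≋ factor-out ⟩
    (sum λ i → w i * sum λ k → A i k * B k j)
      ≈⟨ ⊙-congʳ w (λ i j → sym (⊗≈⊙ A B i j)) j ⟩
    (w ⊙ (A ⊗ B)) j
      ∎
    where
    factor-out : ∀ i → (sum λ k → w i * A i k * B k j) ≈ w i * sum λ k → A i k * B k j
    factor-out i = begin
      (sum λ k → w i * A i k * B k j)
        ≈⟨ sum-cong-≋ {x = λ k → w i * A i k * B k j} (λ k → *-assoc (w i) (A i k) (B k j)) ⟩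
      (sum λ k → w i * (A i k * B k j))
        ≈⟨ *-distribˡ-sum (w i) (λ k → A i k * B k j) ⟨
      w i * sum (λ k → A i k * B k j)
        ∎

  ⊙-identityʳ : ∀ w j → (w ⊙ I4) j ≈ w j
  ⊙-identityʳ _ f0                = solve 4 (λ a b c e → a :* I :+ (b :* O :+ (c :* O :+ (e :* O :+ O))) := a) refl _ _ _ _
  ⊙-identityʳ _ (fs f0)           = solve 4 (λ a b c e → a :* O :+ (b :* I :+ (c :* O :+ (e :* O :+ O))) := b) refl _ _ _ _
  ⊙-identityʳ _ (fs (fs f0))      = solve 4 (λ a b c e → a :* O :+ (b :* O :+ (c :* I :+ (e :* O :+ O))) := c) refl _ _ _ _
  ⊙-identityʳ _ (fs (fs (fs f0))) = solve 4 (λ a b c e → a :* O :+ (b :* O :+ (c :* O :+ (e :* I :+ O))) := e) refl _ _ _ _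

  w⊙A≈v⇒w≈v⊙B : ∀ {A B w v} → (A ⊗ B) ≈M I4 → (∀ j → (w ⊙ A) j ≈ v j) → ∀ j → w j ≈ (v ⊙ B) j
  w⊙A≈v⇒w≈v⊙B {A} {B} {w} {v} AB≈I w⊙A≈v j = begin
    w j                   ≈⟨ ⊙-identityʳ w j ⟨
    (w ⊙ I4) j            ≈⟨ ⊙-congʳ w AB≈I j ⟨
    (w ⊙ (A ⊗ B)) j       ≈⟨ ⊙-assoc w A B j ⟨
    ((w ⊙ A) ⊙ B) j       ≈⟨ ⊙-congˡ B w⊙A≈v j ⟩
    (v ⊙ B) j             ∎

  -- The last row of A

  module _ (1+1≈0 : 1# + 1# ≈ 0#) (inverse : ∀ x → ¬ x ≈ 0# → ∃ λ y → x * y ≈ 1#)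
           (δ b₁ b₂ : Carrier) (b₁≉0 : ¬ b₁ ≈ 0#) (b₁≉b₂ : ¬ b₁ ≈ b₂)
           (A B : Matrix) (AB≈I : (A ⊗ B) ≈M I4)
           (φQδ≈Qδ : φ A (Q δ) ≈Ω Q δ) (φQδ+b₁≈Qδ+b₂ : φ A (Q (δ + b₁)) ≈Ω Q (δ + b₂)) where

    diagonal-shift : ∀ m → Q (δ + b₂) m m ≈ Q δ m m + b₁ * (A i3 m * A i3 m)
    diagonal-shift m = begin
      Q (δ + b₂) m m                                     ≈⟨ φQδ+b₁≈Qδ+b₂ m m (<-irrefl ≡.refl) ⟨
      φ A (Q (δ + b₁)) m m                               ≈⟨ φ-diagonal A (Q (δ + b₁)) m ⟩
      eval (Q (δ + b₁)) (column A m)                     ≈⟨ eval-Q-+ δ b₁ (column A m) ⟩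
      eval (Q δ) (column A m) + b₁ * (A i3 m * A i3 m)   ≈⟨ +-congʳ (φ-diagonal A (Q δ) m) ⟨
      φ A (Q δ) m m + b₁ * (A i3 m * A i3 m)             ≈⟨ +-congʳ (φQδ≈Qδ m m (<-irrefl ≡.refl)) ⟩
      Q δ m m + b₁ * (A i3 m * A i3 m)                   ∎

    lastRow-square≈0 : ∀ {m} → Q (δ + b₂) m m ≡ Q δ m m → A i3 m * A i3 m ≈ 0#
    lastRow-square≈0 {m} Q≡Q = x*y≈0⇒y≈0 inverse b₁≉0
      (identityʳ-unique _ _ (trans (sym (diagonal-shift m)) (reflexive Q≡Q)))

    b₂≈b₁a² : b₂ ≈ b₁ * (A i3 i3 * A i3 i3)
    b₂≈b₁a² = ∙-cancelˡ δ _ _ (diagonal-shift i3)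

    module _ (A₃₀≈0 : A i3 i0 ≈ 0#) (A₃₁≈0 : A i3 i1 ≈ 0#) (A₃₂≈0 : A i3 i2 ≈ 0#) where

      a : Carrier
      a = A i3 i3

      lastRow≈a*e₃ : ∀ k → A i3 k ≈ a * I4 i3 k
      lastRow≈a*e₃ f0                = trans A₃₀≈0 (sym (zeroʳ a))
      lastRow≈a*e₃ (fs f0)           = trans A₃₁≈0 (sym (zeroʳ a))
      lastRow≈a*e₃ (fs (fs f0))      = trans A₃₂≈0 (sym (zeroʳ a))
      lastRow≈a*e₃ (fs (fs (fs f0))) = sym (*-identityʳ a)

      ⟨columns⟩≈Qδ : ∀ {k l} → k < l → ⟨ column A k , column A l ⟩ ≈ Q δ k l
      ⟨columns⟩≈Qδ {k} {l} k<l = begin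
        ⟨ column A k , column A l ⟩               ≈⟨ polarForm-Q 1+1≈0 δ (column A k) (column A l) ⟨
        polarForm (Q δ) (column A k) (column A l) ≈⟨ φ-offdiagonal A (Q δ) (<⇒≢ k<l) ⟨
        φ A (Q δ) k l                             ≈⟨ φQδ≈Qδ k l (<-asym k<l) ⟩
        Q δ k l                                   ∎

      w : Vector Carrier 4
      w = swapPairs (column A i2)

      w⊙A≈e₃ : ∀ j → (w ⊙ A) j ≈ I4 i3 j
      w⊙A≈e₃ f0                = trans (⟨⟩-sym (column A i2) (column A i0)) (⟨columns⟩≈Qδ z<s)
      w⊙A≈e₃ (fs f0)           = trans (⟨⟩-sym (column A i2) (column A i1)) (⟨columns⟩≈Qδ (s<s z<s))
      w⊙A≈e₃ (fs (fs f0))      = ⟨x,x⟩≈0 1+1≈0 (column A i2)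
      w⊙A≈e₃ (fs (fs (fs f0))) = ⟨columns⟩≈Qδ (s<s (s<s z<s))

      a*w≈e₃ : ∀ j → a * w j ≈ I4 i3 j
      a*w≈e₃ j = begin
        a * w j                       ≈⟨ *-congˡ (w⊙A≈v⇒w≈v⊙B {A} {B} {w} AB≈I w⊙A≈e₃ j) ⟩
        a * (I4 i3 ⊙ B) j             ≈⟨ *-distribˡ-⊙ a (I4 i3) B j ⟩
        ((λ k → a * I4 i3 k) ⊙ B) j   ≈⟨ ⊙-congˡ B lastRow≈a*e₃ j ⟨
        (A i3 ⊙ B) j                  ≈⟨ ⊗≈⊙ A B i3 j ⟨
        (A ⊗ B) i3 j                  ≈⟨ AB≈I i3 j ⟩
        I4 i3 j                       ∎

      a*a≈1 : a * a ≈ 1#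
      a*a≈1 = begin
        a * a
          ≈⟨ *-identityʳ (a * a) ⟨
        a * a * 1#
          ≈⟨ *-congˡ Q-column₂ ⟨
        a * a * (A i0 i2 * A i1 i2 + A i2 i2 * A i2 i2)
          ≈⟨ rearrange a (A i0 i2) (A i1 i2) (A i2 i2) ⟩
        A i0 i2 * (a * A i1 i2) * a + (a * A i2 i2) * (a * A i2 i2)
          ≈⟨ +-cong (*-congʳ (*-congˡ (a*w≈e₃ i0))) (*-cong (a*w≈e₃ i3) (a*w≈e₃ i3)) ⟩
        A i0 i2 * 0# * a + 1# * 1#
          ≈⟨ +-cong (trans (*-congʳ (zeroʳ (A i0 i2))) (zeroˡ a)) (*-identityˡ 1#) ⟩
        0# + 1#
          ≈⟨ +-identityˡ 1# ⟩
        1#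
          ∎
        where
        Q-column₂ : A i0 i2 * A i1 i2 + A i2 i2 * A i2 i2 ≈ 1#
        Q-column₂ = begin
          A i0 i2 * A i1 i2 + A i2 i2 * A i2 i2   ≈⟨ eval-Q-x3≈0 δ (column A i2) A₃₂≈0 ⟨
          eval (Q δ) (column A i2)                ≈⟨ φ-diagonal A (Q δ) i2 ⟨
          φ A (Q δ) i2 i2                         ≈⟨ φQδ≈Qδ i2 i2 (<-irrefl {x = i2} ≡.refl) ⟩
          1#                                      ∎
        rearrange : ∀ a p q r → a * a * (p * q + r * r) ≈ p * (a * q) * a + (a * r) * (a * r)
        rearrange = solve 4 (λ a p q r → a :* a :* (p :* q :+ r :* r)
          := p :* (a :* q) :* a :+ (a :* r) :* (a :* r)) refl

    absurd : ⊥
    absurd =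
      x*x≈0⇒¬¬x≈0 inverse (lastRow-square≈0 {i0} ≡.refl) λ A₃₀≈0 →
      x*x≈0⇒¬¬x≈0 inverse (lastRow-square≈0 {i1} ≡.refl) λ A₃₁≈0 →
      x*x≈0⇒¬¬x≈0 inverse (lastRow-square≈0 {i2} ≡.refl) λ A₃₂≈0 →
      b₁≉b₂ (sym (begin
        b₂                        ≈⟨ b₂≈b₁a² ⟩
        b₁ * (A i3 i3 * A i3 i3)  ≈⟨ *-congˡ (a*a≈1 A₃₀≈0 A₃₁≈0 A₃₂≈0) ⟩
        b₁ * 1#                   ≈⟨ *-identityʳ b₁ ⟩
        b₁                        ∎))

lemma4p5 : ∀ {c ℓ : Level} (R : CommutativeRing c ℓ) (h : ℕ) → IsFieldOfOrder R (2 ^ h) →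
  let open CommutativeRing R
      open FieldNotions R
  in ∀ (δ b₁ b₂ : Carrier) → ¬ (δ ≈ 0#) → ¬ (b₁ ≈ 0#) → ¬ (b₂ ≈ 0#) →
     Tr h δ ≈ 1# → Tr h b₁ ≈ 0# → Tr h b₂ ≈ 0# → ¬ (b₁ ≈ b₂) →
     ¬ (∃ λ (A : Matrix) → IsInvertible A × φ A (Q δ) ≈Ω Q δ × φ A (Q (δ + b₁)) ≈Ω Q (δ + b₂))
lemma4p5 R h F δ b₁ b₂ _ b₁≉0 _ _ _ _ b₁≉b₂ (A , (B , AB≈I , _) , φQδ≈Qδ , φQδ+b₁≈Qδ+b₂) =
  characteristic-two R {h} F λ 1+1≈0 →
    absurd R 1+1≈0 (IsFieldOfOrder.inverse F) δ b₁ b₂ b₁≉0 b₁≉b₂ A B AB≈I φQδ≈Qδ φQδ+b₁≈Qδ+b₂
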